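{- Let $G$ be a connected digraph, $X \subseteq V(G)$ connected and $L$ a list-assignment of $G$ such that $G-X$ is $L$-dicolourable, $G$ is not $L$-dicolourable and $\forall x \in X, \lvert L(x)\rvert \ge d_{\max}(x)$. Then, for every $x \in X$, the following statements hold: 1. $\lvert L(x)\rvert = d^+(x) = d^-(x)$, 2. $G-x$ is $L$-dicolourable. 3. For every $L$-dicolouring of $G-x$, every colour of $L(x)$ appears in both $N^+(x)$ and $N^-(x)$. 4. Given an $L$-dicolouring $\phi$ of $G-x$ and $y \in X \cap N(x)$, uncolouring $y$ and colouring $x$ with the colour of $y$ yields an $L$-dicolouring of $G-y$.
   Context: A list assignment maps each vertex $v$ to a set $L(v)$ of colours; an $L$-dicolouring is an assignment $\phi(v)\in L(v)$ with every colour class inducing an acyclic subdigraph. $X$ connected means $G[X]$ is weakly connected. $d_{\max}(x)=\max(d^+(x),d^-(x))$; $N^+(x)$, $N^-(x)$, $N(x)$ are out-, in-, and full neighbourhoods of $x$. -}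

module Defs where

open import Data.Nat using (ℕ)
open import Data.Nat.Properties using (_≟_)
open import Data.Bool using (Bool; true; false; if_then_else_)
open import Data.Fin using (Fin)
open import Data.Fin.Properties using () renaming (_≟_ to _≟ᶠ_)
open import Data.Fin.Subset using (Subset; _∈_; _∉_)
open import Data.List using (List; []; _∷_; _++_; [_]; length; filterᵇ; deduplicate)
open import Data.List.Membership.Propositional using () renaming (_∈_ to _∈ˡ_)
open import Data.List.Relation.Unary.All using (All)
open import Data.List.Relation.Unary.Unique.Propositional using (Unique)
open import Data.List.Base using (allFin)
open import Data.Product using (Σ; _×_; _,_; ∃)
open import Data.Sum using (_⊎_)
open import Data.Empty using (⊥)
open import Data.Unit using (⊤)
open import Relation.Nullary using (¬_; does)
open import Relation.Binary.PropositionalEquality using (_≡_; _≢_)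

-- A (simple, loopless) digraph on vertex set Fin n; digons allowed,
-- no parallel arcs.  arc u v ≡ true  means  u → v  is an arc.
record Digraph (n : ℕ) : Set where
  field
    arc      : Fin n → Fin n → Bool
    loopless : ∀ v → arc v v ≡ false
open Digraph public

module _ {n : ℕ} (G : Digraph n) where

  Arc : Fin n → Fin n → Set
  Arc u v = arc G u v ≡ true

  outdeg : Fin n → ℕ
  outdeg x = length (filterᵇ (λ y → arc G x y) (allFin n))

  indeg : Fin n → ℕ
  indeg x = length (filterᵇ (λ y → arc G y x) (allFin n))

  data Path : List (Fin n) → Set where
    single : ∀ v → Path (v ∷ [])
    cons   : ∀ u v vs → Arc u v → Path (v ∷ vs) → Path (u ∷ v ∷ vs)

  record DirCycle (T : Fin n → Set) : Set where
    field
      start  : Fin n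
      rest   : List (Fin n)
      unique : Unique (start ∷ rest)
      inT    : All T (start ∷ rest)
      closed : Path ((start ∷ rest) ++ [ start ])

  Acyclic : (T : Fin n → Set) → Set
  Acyclic T = ¬ DirCycle T

  -- φ is an L-dicolouring of the induced subdigraph G[S]
  -- (values of φ outside S are irrelevant)
  IsDicolouring : (L : Fin n → List ℕ) (S : Fin n → Set) (φ : Fin n → ℕ) → Set
  IsDicolouring L S φ =
    (∀ v → S v → φ v ∈ˡ L v) ×
    (∀ (c : ℕ) → Acyclic (λ v → S v × φ v ≡ c))

  Dicolourable : (L : Fin n → List ℕ) (S : Fin n → Set) → Set
  Dicolourable L S = ∃ λ φ → IsDicolouring L S φ

  -- weak (underlying undirected) reachability inside T
  data Reach (T : Fin n → Set) : Fin n → Fin n → Set where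
    here : ∀ {u} → T u → Reach T u u
    fwd  : ∀ {u v w} → T u → Arc u v → Reach T v w → Reach T u w
    bwd  : ∀ {u v w} → T u → Arc v u → Reach T v w → Reach T u w

  Connected : (T : Fin n → Set) → Set
  Connected T = ∀ u v → T u → T v → Reach T u v

card : List ℕ → ℕ
card l = length (deduplicate _≟_ l)

recolour : ∀ {n} → (Fin n → ℕ) → Fin n → Fin n → (Fin n → ℕ)
recolour φ x y v = if does (v ≟ᶠ x) then φ y else φ v

AllV : ∀ {n} → Fin n → Set
AllV _ = ⊤

InSub : ∀ {n} → Subset n → Fin n → Set
InSub X v = v ∈ X

OutSub : ∀ {n} → Subset n → Fin n → Set
OutSub X v = v ∉ X

Minus : ∀ {n} → Fin n → Fin n → Set
Minus x v = v ≢ x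

-- If a colour c ∈ L(v) is missing from N⁺(v) (or from N⁻(v)) in a dicolouring of
-- G[S], then colouring v with c dicolours G[S ∪ {v}]: a monochromatic cycle through
-- v would leave (enter) v through a vertex of colour c.  Starting from a dicolouring
-- of G − X, colour X ∖ {x} in order of decreasing distance to x in G[X]; every vertex
-- then still has an uncoloured neighbour (one step closer to x), so |L(v)| ≥ d_max(v)
-- leaves a colour missing from its out- or in-neighbourhood.  In a dicolouring of
-- G − x, a colour of L(x) missing from N⁺(x) or N⁻(x) would dicolour G; hence L(x) is
-- covered by the colours of N⁺(x) and of N⁻(x), which forces |L(x)| = d⁺(x) = d⁻(x)
-- and makes the colouring injective on each of them, with values in L(x).  So the
-- colour of a neighbour y of x is missing from the rest of that neighbourhood of x.
module Submission where

open import Defs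
open import Data.Nat using (ℕ; _≥_)
open import Data.Fin using (Fin)
open import Data.Fin.Subset using (Subset; _∈_)
open import Data.List using (List)
open import Data.List.Membership.Propositional using () renaming (_∈_ to _∈ˡ_)
open import Data.Nat using (_⊔_)
open import Data.Product using (_×_; ∃)
open import Data.Sum using (_⊎_)
open import Relation.Nullary using (¬_)
open import Relation.Binary.PropositionalEquality using (_≡_)

open import Level using (0ℓ)
open import Function using (_∘_; id; const; Equivalence)
open import Data.Nat using (suc; zero; _≤_; _<_; _≤′_; ≤′-reflexive; ≤′-step; s≤s; z≤n)
open import Data.Nat.Properties using (≤-trans; ≤⇒≤′; <⇒≱; m≤m⊔n; m≤n⊔m; ≤-antisym; n<1+n; module ≤-Reasoning)
  renaming (_≟_ to _≟ℕ_)
open import Data.Bool using (Bool; true; false; if_then_else_; T?)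
open import Data.Bool.Properties using (T-≡) renaming (_≟_ to _≟ᵇ_)
open import Data.Empty using (⊥-elim)
open import Data.Fin.Properties using (any?) renaming (_≟_ to _≟ᶠ_)
open import Data.Fin.Subset.Properties using () renaming (_∈?_ to _∈ˢ?_)
open import Data.List using ([]; _∷_; _++_; [_]; length; map; filterᵇ; allFin)
open import Data.List.Properties using (length-map; length-removeAt′)
open import Data.List.Relation.Unary.Any as Any using (Any; here; there; index)
import Data.List.Relation.Unary.All as All
open import Data.List.Relation.Unary.AllPairs using (_∷_)
open import Data.List.Relation.Unary.Unique.Propositional using (Unique)
open import Data.List.Relation.Unary.Unique.DecPropositional.Properties using (deduplicate-!)
open import Data.List.Relation.Binary.Subset.Propositional using () renaming (_⊆_ to _⊆ˡ_)
open import Data.List.Membership.Propositional using (_─_; find; lose)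
open import Data.List.Membership.Propositional.Properties
  using (∈-allFin; ∈-filter⁺; ∈-map⁺; ∈-map⁻; ∈-deduplicate⁻; ∈-++⁻; ∈-++⁺ˡ; ∈-++⁺ʳ)
open import Data.List.Membership.DecPropositional _≟ℕ_ using () renaming (_∈?_ to _∈ℕ?_)
import Data.List.Membership.DecPropositional as DecMembership
open import Data.Product using (_,_; proj₁; proj₂)
open import Data.Sum using (inj₁; inj₂)
open import Relation.Nullary using (Dec; yes; no; does; ¬?)
open import Relation.Nullary.Decidable using (decidable-stable; _×-dec_; _⊎-dec_)
open import Relation.Unary using (Pred; Decidable; _⊆_; _∪_; _∩_; ∁; ｛_｝)
open import Relation.Binary.Definitions using (DecidableEquality)
open import Relation.Binary.PropositionalEquality using (_≢_; refl; sym; trans; subst)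

module _ {a} {A : Set a} where

  ∈-++-redundant⁻ : ∀ {s u : A} xs → s ∈ˡ xs → u ∈ˡ xs ++ [ s ] → u ∈ˡ xs
  ∈-++-redundant⁻ xs s∈xs u∈ with ∈-++⁻ xs u∈
  ... | inj₁ u∈xs        = u∈xs
  ... | inj₂ (here refl) = s∈xs

  ∈-rotate : ∀ {s v : A} xs → v ∈ˡ s ∷ xs → v ∈ˡ xs ++ [ s ]
  ∈-rotate xs (here refl) = ∈-++⁺ʳ xs (here refl)
  ∈-rotate xs (there v∈)  = ∈-++⁺ˡ v∈

  ∈-─⁺ : ∀ {u w} {ws : List A} (p : u ∈ˡ ws) → w ∈ˡ ws → w ≢ u → w ∈ˡ ws ─ p
  ∈-─⁺ (here refl) (here refl) w≢u = ⊥-elim (w≢u refl)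
  ∈-─⁺ (here refl) (there q)   _   = q
  ∈-─⁺ (there p)   (here refl) _   = here refl
  ∈-─⁺ (there p)   (there q)   w≢u = there (∈-─⁺ p q w≢u)

  length-─ : ∀ {u} (ws : List A) (p : u ∈ˡ ws) → length ws ≡ suc (length (ws ─ p))
  length-─ ws p = length-removeAt′ ws (index p)

  Unique⇒length-≤ : ∀ {xs ys : List A} → Unique xs → xs ⊆ˡ ys → length xs ≤ length ys
  Unique⇒length-≤ {[]}     _               _     = z≤n
  Unique⇒length-≤ {x ∷ xs} {ys} (x∉xs ∷ unique) xs⊆ys = begin
    suc (length xs)          ≤⟨ s≤s (Unique⇒length-≤ unique xs⊆ys─x) ⟩
    suc (length (ys ─ x∈ys)) ≡⟨ length-─ ys x∈ys ⟨
    length ys                ∎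
    where
    open ≤-Reasoning
    x∈ys : x ∈ˡ ys
    x∈ys = xs⊆ys (here refl)
    xs⊆ys─x : xs ⊆ˡ ys ─ x∈ys
    xs⊆ys─x z∈xs = ∈-─⁺ x∈ys (xs⊆ys (there z∈xs)) λ { refl → All.lookup x∉xs z∈xs refl }

module _ {a} {A : Set a} where

  card≤length : (φ : A → ℕ) {l : List ℕ} {ws : List A} → l ⊆ˡ map φ ws → card l ≤ length ws
  card≤length φ {l} {ws} l⊆φws = begin
    card l            ≤⟨ Unique⇒length-≤ (deduplicate-! _≟ℕ_ l) (l⊆φws ∘ ∈-deduplicate⁻ _≟ℕ_ l) ⟩
    length (map φ ws) ≡⟨ length-map φ ws ⟩
    length ws         ∎
    where open ≤-Reasoning

  card<length : (φ : A → ℕ) {l : List ℕ} {ws : List A} {u : A} (p : u ∈ˡ ws)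
              → l ⊆ˡ map φ (ws ─ p) → card l < length ws
  card<length φ {l} {ws} p l⊆ = begin-strict
    card l                ≤⟨ card≤length φ l⊆ ⟩
    length (ws ─ p)       <⟨ n<1+n _ ⟩
    suc (length (ws ─ p)) ≡⟨ length-─ ws p ⟨
    length ws             ∎
    where open ≤-Reasoning

  module _ (φ : A → ℕ) {l : List ℕ} {ws : List A}
           (l⊆φws : l ⊆ˡ map φ ws) (tight : length ws ≤ card l) where

    private
      irredundant : ∀ {u} (p : u ∈ˡ ws) → ¬ (l ⊆ˡ map φ (ws ─ p))
      irredundant p l⊆ = <⇒≱ (card<length φ p l⊆) tight

    tight-cover-colours : ∀ {u} → u ∈ˡ ws → φ u ∈ˡ l
    tight-cover-colours {u} u∈ws = decidable-stable (φ u ∈ℕ? l) (irredundant u∈ws ∘ l⊆)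
      where
      l⊆ : ¬ φ u ∈ˡ l → l ⊆ˡ map φ (ws ─ u∈ws)
      l⊆ φu∉l c∈l with ∈-map⁻ φ (l⊆φws c∈l)
      ... | w , w∈ws , refl = ∈-map⁺ φ (∈-─⁺ u∈ws w∈ws λ { refl → φu∉l c∈l })

    tight-cover-injective : DecidableEquality A → ∀ {u z} → u ∈ˡ ws → z ∈ˡ ws → z ≢ u → φ z ≢ φ u
    tight-cover-injective eq? {u} {z} u∈ws z∈ws z≢u φz≡φu = irredundant u∈ws l⊆
      where
      l⊆ : l ⊆ˡ map φ (ws ─ u∈ws)
      l⊆ c∈l with ∈-map⁻ φ (l⊆φws c∈l)
      ... | w , w∈ws , refl with eq? w u
      ...   | yes refl = subst (_∈ˡ map φ (ws ─ u∈ws)) φz≡φu (∈-map⁺ φ (∈-─⁺ u∈ws z∈ws z≢u))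
      ...   | no w≢u   = ∈-map⁺ φ (∈-─⁺ u∈ws w∈ws w≢u)

module _ {a p} {A : Set a} (P : ℕ → Pred A p) (P-suc : ∀ {k} → P k ⊆ P (suc k)) where

  private
    P-mono : ∀ {k m} → k ≤′ m → P k ⊆ P m
    P-mono (≤′-reflexive refl) = id
    P-mono (≤′-step k≤′m)      = P-suc ∘ P-mono k≤′m

  common-threshold : (∀ x → ∃ λ k → P k x) → ∀ xs → ∃ λ M → ∀ {x} → x ∈ˡ xs → P M x
  common-threshold _         []       = 0 , λ ()
  common-threshold threshold (x ∷ xs) with threshold x | common-threshold threshold xs
  ... | k , Pkx | M , PM = k ⊔ M , λ where
    (here refl) → P-mono (≤⇒≤′ (m≤m⊔n k M)) Pkx
    (there i)   → P-mono (≤⇒≤′ (m≤n⊔m k M)) (PM i)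

data Direction : Set where
  outward inward : Direction

-- recolour φ x y is definitionally update φ x (φ y).
update : ∀ {n} → (Fin n → ℕ) → Fin n → ℕ → Fin n → ℕ
update φ v c w = if does (w ≟ᶠ v) then c else φ w

module _ {n : ℕ} (φ : Fin n → ℕ) (c : ℕ) where

  update-≡ : ∀ v → update φ v c v ≡ c
  update-≡ v with v ≟ᶠ v
  ... | yes _   = refl
  ... | no v≢v = ⊥-elim (v≢v refl)

  update-≢ : ∀ {v w} → w ≢ v → update φ v c w ≡ φ w
  update-≢ {v} {w} w≢v with w ≟ᶠ v
  ... | yes w≡v = ⊥-elim (w≢v w≡v)
  ... | no _    = refl

module _ {n : ℕ} (G : Digraph n) where

  nbr : Direction → Fin n → Fin n → Bool
  nbr outward v w = arc G v w
  nbr inward  v w = arc G w v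

  Nbr : Direction → Fin n → Fin n → Set
  Nbr d v w = nbr d v w ≡ true

  nbr? : ∀ d v w → Dec (Nbr d v w)
  nbr? d v w = nbr d v w ≟ᵇ true

  nbrs : Direction → Fin n → List (Fin n)
  nbrs d v = filterᵇ (nbr d v) (allFin n)

  degree : Direction → Fin n → ℕ
  degree d v = length (nbrs d v)

  degree≤dmax : ∀ d v → degree d v ≤ outdeg G v ⊔ indeg G v
  degree≤dmax outward v = m≤m⊔n _ _
  degree≤dmax inward  v = m≤n⊔m _ _

  Nbr⇒∈nbrs : ∀ d {v w} → Nbr d v w → w ∈ˡ nbrs d v
  Nbr⇒∈nbrs d {v} {w} v→w = ∈-filter⁺ (T? ∘ nbr d v) (∈-allFin w) (Equivalence.from T-≡ v→w)

  nbr-loopless : ∀ d v → nbr d v v ≡ false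
  nbr-loopless outward = loopless G
  nbr-loopless inward  = loopless G

  Nbr⇒≢ : ∀ d {v w} → Nbr d v w → w ≢ v
  Nbr⇒≢ d {v} v→v refl with trans (sym v→v) (nbr-loopless d v)
  ... | ()

  Adjacent : Fin n → Fin n → Set
  Adjacent v w = Arc G v w ⊎ Arc G w v

  adjacent? : ∀ v w → Dec (Adjacent v w)
  adjacent? v w = nbr? outward v w ⊎-dec nbr? inward v w

  Adjacent⇒Nbr : ∀ {v w} → Adjacent v w → ∃ λ d → Nbr d v w
  Adjacent⇒Nbr (inj₁ v→w) = outward , v→w
  Adjacent⇒Nbr (inj₂ w→v) = inward , w→v

  vertices : ∀ {T} → DirCycle G T → List (Fin n)
  vertices C = DirCycle.start C ∷ DirCycle.rest C

  private
    arc-from : ∀ xs s {v} → Path G (xs ++ [ s ]) → v ∈ˡ xs → ∃ λ u → Arc G v u × u ∈ˡ xs ++ [ s ]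
    arc-from (x ∷ [])     s (cons _ _ _ x→s _) (here refl) = s , x→s , there (here refl)
    arc-from (x ∷ [])     s _                  (there ())
    arc-from (x ∷ y ∷ xs) s (cons _ _ _ x→y _) (here refl) = y , x→y , there (here refl)
    arc-from (x ∷ y ∷ xs) s (cons _ _ _ _ path) (there v∈) with arc-from (y ∷ xs) s path v∈
    ... | u , v→u , u∈ = u , v→u , there u∈

    arc-into : ∀ a l {v} → Path G (a ∷ l) → v ∈ˡ l → ∃ λ u → Arc G u v × u ∈ˡ a ∷ l
    arc-into a (b ∷ l) (cons _ _ _ a→b _)  (here refl) = a , a→b , here refl
    arc-into a (b ∷ l) (cons _ _ _ _ path) (there v∈) with arc-into b l path v∈
    ... | u , u→v , u∈ = u , u→v , there u∈

  cycle-nbr : ∀ {T} (C : DirCycle G T) {v} → v ∈ˡ vertices C → ∀ d → ∃ λ u → Nbr d v u × T u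
  cycle-nbr C {v} v∈C d =
    let u , v~u , u∈ = step d in u , v~u , All.lookup inT (∈-++-redundant⁻ (vertices C) (here refl) u∈)
    where
    open DirCycle C
    step : ∀ d → ∃ λ u → Nbr d v u × u ∈ˡ vertices C ++ [ start ]
    step outward = arc-from (vertices C) start closed v∈C
    step inward  = arc-into start (rest ++ [ start ]) closed (∈-rotate rest v∈C)

  DirCycle-map : ∀ {T T′ : Fin n → Set} (C : DirCycle G T)
               → (∀ {w} → w ∈ˡ vertices C → T w → T′ w) → DirCycle G T′
  DirCycle-map C f = record
    { start  = start
    ; rest   = rest
    ; unique = unique
    ; inT    = All.tabulate λ w∈C → f w∈C (All.lookup inT w∈C)
    ; closed = closed
    }
    where open DirCycle C

  Absent : (Fin n → ℕ) → Pred (Fin n) 0ℓ → Direction → Fin n → ℕ → Set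
  Absent φ S d v c = ∀ {w} → S w → Nbr d v w → φ w ≢ c

  module _ {L : Fin n → List ℕ} where

    IsDicolouring-⊆ : ∀ {S S′ φ} → IsDicolouring G L S φ → S′ ⊆ S → IsDicolouring G L S′ φ
    IsDicolouring-⊆ (φ∈L , acyclic) S′⊆S =
      (λ w → φ∈L w ∘ S′⊆S) , λ c C → acyclic c (DirCycle-map C λ _ (s , φw≡c) → S′⊆S s , φw≡c)

    Dicolourable-⊆ : ∀ {S S′} → Dicolourable G L S → S′ ⊆ S → Dicolourable G L S′
    Dicolourable-⊆ (φ , D) S′⊆S = φ , IsDicolouring-⊆ D S′⊆S

    extend : ∀ {S φ v c} d → IsDicolouring G L S φ → c ∈ˡ L v → Absent φ S d v c
           → IsDicolouring G L (S ∪ ｛ v ｝) (update φ v c)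
    extend {S} {φ} {v} {c} d (φ∈L , acyclic) c∈Lv absent = coloured , acyclic′
      where
      open DecMembership (_≟ᶠ_ {n}) using () renaming (_∈?_ to _∈ᶠ?_)

      old : ∀ {w} → (S ∪ ｛ v ｝) w → w ≢ v → S w
      old (inj₁ s)    _   = s
      old (inj₂ refl) w≢v = ⊥-elim (w≢v refl)

      coloured : ∀ w → (S ∪ ｛ v ｝) w → update φ v c w ∈ˡ L w
      coloured w s with w ≟ᶠ v
      ... | yes refl = c∈Lv
      ... | no w≢v   = φ∈L w (old s w≢v)

      acyclic′ : ∀ c′ → Acyclic G (λ w → (S ∪ ｛ v ｝) w × update φ v c w ≡ c′)
      acyclic′ c′ C with v ∈ᶠ? vertices C
      ... | no v∉C = acyclic c′ (DirCycle-map C λ {w} w∈C (s , c′-coloured) →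
              let w≢v : w ≢ v
                  w≢v = λ { refl → v∉C w∈C }
              in old s w≢v , trans (sym (update-≢ φ c w≢v)) c′-coloured)
      ... | yes v∈C with cycle-nbr C v∈C d
      ...   | u , v→u , s , c′-coloured = absent (old s u≢v) v→u φu≡c
        where
        u≢v : u ≢ v
        u≢v = Nbr⇒≢ d v→u
        c≡c′ : c ≡ c′
        c≡c′ = trans (sym (update-≡ φ c v)) (proj₂ (All.lookup (DirCycle.inT C) v∈C))
        φu≡c : φ u ≡ c
        φu≡c = trans (trans (sym (update-≢ φ c u≢v)) c′-coloured) (sym c≡c′)

    free-colour : ∀ {S} φ d {v u} → Nbr d v u → ¬ S u → degree d v ≤ card (L v)
                → ∃ λ c → c ∈ˡ L v × Absent φ S d v c
    free-colour {S} φ d {v} {u} v→u ¬Su deg≤ =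
      let c , c∈Lv , c∉others = find missing in c , c∈Lv , absent c∉others
      where
      u∈nbrs : u ∈ˡ nbrs d v
      u∈nbrs = Nbr⇒∈nbrs d v→u
      others : List ℕ
      others = map φ (nbrs d v ─ u∈nbrs)
      missing : Any (λ c → ¬ c ∈ˡ others) (L v)
      missing = decidable-stable (Any.any? (λ c → ¬? (c ∈ℕ? others)) (L v)) λ ¬missing →
        <⇒≱ (card<length φ u∈nbrs λ {c} c∈Lv → decidable-stable (c ∈ℕ? others) (¬missing ∘ lose c∈Lv)) deg≤
      absent : ∀ {c} → ¬ c ∈ˡ others → Absent φ S d v c
      absent c∉others s v→w refl =
        c∉others (∈-map⁺ φ (∈-─⁺ u∈nbrs (Nbr⇒∈nbrs d v→w) λ { refl → ¬Su s }))

    -- Requiring ¬ U u keeps the witness u uncoloured while U is coloured one vertex at a time.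
    greedy-extension : ∀ {S U} → Decidable U
      → (∀ {v} → U v → ∃ λ d → ∃ λ u → Nbr d v u × ¬ S u × ¬ U u)
      → (∀ {v} → U v → ∀ d → degree d v ≤ card (L v))
      → Dicolourable G L S → Dicolourable G L (S ∪ U)
    greedy-extension {S} {U} U? exit deg≤ D =
      Dicolourable-⊆ (extend-along (allFin n)) λ where
        (inj₁ s)  → inj₁ s
        (inj₂ Uw) → inj₂ (Uw , ∈-allFin _)
      where
      extend-along : ∀ ys → Dicolourable G L (S ∪ (U ∩ (_∈ˡ ys)))
      extend-along [] = Dicolourable-⊆ D λ where
        (inj₁ s) → s
        (inj₂ (_ , ()))
      extend-along (v ∷ ys) with extend-along ys | U? v
      ... | D′ | no ¬Uv = Dicolourable-⊆ D′ λ where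
        (inj₁ s)                → inj₁ s
        (inj₂ (Uv , here refl)) → ⊥-elim (¬Uv Uv)
        (inj₂ (Uw , there w∈))  → inj₂ (Uw , w∈)
      ... | φ , Dφ | yes Uv with exit Uv
      ...   | d , u , v→u , ¬Su , ¬Uu =
        let c , c∈Lv , absent = free-colour φ d v→u ¬uncoloured (deg≤ Uv d) in
        update φ v c , IsDicolouring-⊆ (extend d Dφ c∈Lv absent) λ where
          (inj₁ s)               → inj₁ (inj₁ s)
          (inj₂ (_ , here refl)) → inj₂ refl
          (inj₂ (Uw , there w∈)) → inj₁ (inj₂ (Uw , w∈))
        where
        ¬uncoloured : ¬ (S ∪ (U ∩ (_∈ˡ ys))) u
        ¬uncoloured (inj₁ Su)       = ¬Su Su
        ¬uncoloured (inj₂ (Uu , _)) = ¬Uu Uu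

    colour-appears : ¬ Dicolourable G L AllV → ∀ {φ x} → IsDicolouring G L (Minus x) φ
                   → ∀ {c} → c ∈ˡ L x → ∀ d → ∃ λ y → Nbr d x y × φ y ≡ c
    colour-appears ¬col {φ} {x} D {c} c∈Lx d with any? (λ y → nbr? d x y ×-dec φ y ≟ℕ c)
    ... | yes found = found
    ... | no ¬found =
      ⊥-elim (¬col (update φ x c , IsDicolouring-⊆ (extend d D c∈Lx absent) everywhere))
      where
      absent : Absent φ (Minus x) d x c
      absent _ x→y φy≡c = ¬found (_ , x→y , φy≡c)
      everywhere : AllV ⊆ Minus x ∪ ｛ x ｝
      everywhere {w} _ with w ≟ᶠ x
      ... | yes w≡x = inj₂ (sym w≡x)
      ... | no w≢x  = inj₁ w≢x

    colours⊆nbr-colours : ¬ Dicolourable G L AllV → ∀ {φ x} → IsDicolouring G L (Minus x) φ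
                        → ∀ d → L x ⊆ˡ map φ (nbrs d x)
    colours⊆nbr-colours ¬col {φ} D d c∈Lx with colour-appears ¬col D c∈Lx d
    ... | y , x→y , refl = ∈-map⁺ φ (Nbr⇒∈nbrs d x→y)

    card≡degree : ¬ Dicolourable G L AllV → ∀ {φ x} → IsDicolouring G L (Minus x) φ
                → ∀ d → degree d x ≤ card (L x) → card (L x) ≡ degree d x
    card≡degree ¬col {φ} D d deg≤ = ≤-antisym (card≤length φ (colours⊆nbr-colours ¬col D d)) deg≤

    recolour-dicolouring : ¬ Dicolourable G L AllV → ∀ {φ x y} → IsDicolouring G L (Minus x) φ
                         → (∀ d → degree d x ≤ card (L x)) → Adjacent x y
                         → IsDicolouring G L (Minus y) (recolour φ x y)
    recolour-dicolouring ¬col {φ} {x} {y} D deg≤ xy with Adjacent⇒Nbr xy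
    ... | d , x→y = IsDicolouring-⊆ (extend d (IsDicolouring-⊆ D proj₁) φy∈Lx absent) split
      where
      cover : L x ⊆ˡ map φ (nbrs d x)
      cover = colours⊆nbr-colours ¬col D d
      y∈nbrs : y ∈ˡ nbrs d x
      y∈nbrs = Nbr⇒∈nbrs d x→y
      φy∈Lx : φ y ∈ˡ L x
      φy∈Lx = tight-cover-colours φ cover (deg≤ d) y∈nbrs
      absent : Absent φ (Minus x ∩ Minus y) d x (φ y)
      absent (_ , w≢y) x→w = tight-cover-injective φ cover (deg≤ d) _≟ᶠ_ y∈nbrs (Nbr⇒∈nbrs d x→w) w≢y
      split : Minus y ⊆ (Minus x ∩ Minus y) ∪ ｛ x ｝
      split {w} w≢y with w ≟ᶠ x
      ... | yes refl = inj₂ refl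
      ... | no w≢x   = inj₁ (w≢x , w≢y)

module Layers {n : ℕ} (G : Digraph n) (X : Subset n) (x : Fin n) where

  Within : ℕ → Pred (Fin n) 0ℓ
  Within zero    w = w ≡ x
  Within (suc k) w = Within k w ⊎ (w ∈ X × ∃ λ u → Adjacent G w u × Within k u)

  within? : ∀ k → Decidable (Within k)
  within? zero    w = w ≟ᶠ x
  within? (suc k) w = within? k w ⊎-dec (w ∈ˢ? X ×-dec any? λ u → adjacent? G w u ×-dec within? k u)

  Layer : ℕ → Pred (Fin n) 0ℓ
  Layer k = Within (suc k) ∩ ∁ (Within k)

  layer? : ∀ k → Decidable (Layer k)
  layer? k w = within? (suc k) w ×-dec ¬? (within? k w)

  Layer⇒step : ∀ {k w} → Layer k w → w ∈ X × ∃ λ u → Adjacent G w u × Within k u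
  Layer⇒step (inj₁ w∈Wk , w∉Wk) = ⊥-elim (w∉Wk w∈Wk)
  Layer⇒step (inj₂ step , _)    = step

  Reach⇒Within : ∀ {w} → Reach G (InSub X) w x → ∃ λ k → Within k w
  Reach⇒Within (here _) = 0 , refl
  Reach⇒Within (fwd {v = v} w∈X w→v r) with Reach⇒Within r
  ... | k , v∈Wk = suc k , inj₂ (w∈X , v , inj₁ w→v , v∈Wk)
  Reach⇒Within (bwd {v = v} w∈X v→w r) with Reach⇒Within r
  ... | k , v∈Wk = suc k , inj₂ (w∈X , v , inj₂ v→w , v∈Wk)

  X⊆Within : Connected G (InSub X) → x ∈ X → ∃ λ M → ∀ {w} → w ∈ X → Within M w
  X⊆Within connected x∈X =
    let M , bound = common-threshold (λ k w → w ∈ X → Within k w) (inj₁ ∘_) threshold (allFin n)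
    in M , bound (∈-allFin _)
    where
    threshold : ∀ w → ∃ λ k → w ∈ X → Within k w
    threshold w with w ∈ˢ? X
    ... | yes w∈X = let k , w∈Wk = Reach⇒Within (connected w x w∈X x∈X) in k , const w∈Wk
    ... | no w∉X  = 0 , ⊥-elim ∘ w∉X

  module _ {L : Fin n → List ℕ} (dmax : ∀ v → v ∈ X → card (L v) ≥ outdeg G v ⊔ indeg G v) where

    peel-layer : ∀ k → Dicolourable G L (∁ (Within (suc k))) → Dicolourable G L (∁ (Within k))
    peel-layer k D = Dicolourable-⊆ G (greedy-extension G (layer? k) exit deg≤ D) split
      where
      exit : ∀ {v} → Layer k v → ∃ λ d → ∃ λ u → Nbr G d v u × ¬ ∁ (Within (suc k)) u × ¬ Layer k u
      exit v∈Lk with Layer⇒step v∈Lk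
      ... | _ , u , vu , u∈Wk with Adjacent⇒Nbr G vu
      ...   | d , v→u = d , u , v→u , (λ u∉Wsk → u∉Wsk (inj₁ u∈Wk)) , λ (_ , u∉Wk) → u∉Wk u∈Wk
      deg≤ : ∀ {v} → Layer k v → ∀ d → degree G d v ≤ card (L v)
      deg≤ {v} v∈Lk d = ≤-trans (degree≤dmax G d v) (dmax v (proj₁ (Layer⇒step v∈Lk)))
      split : ∁ (Within k) ⊆ ∁ (Within (suc k)) ∪ Layer k
      split {w} w∉Wk with within? (suc k) w
      ... | yes w∈Wsk = inj₂ (w∈Wsk , w∉Wk)
      ... | no w∉Wsk  = inj₁ w∉Wsk

    peel-layers : ∀ k → Dicolourable G L (∁ (Within k)) → Dicolourable G L (Minus x)
    peel-layers zero    D = D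
    peel-layers (suc k) D = peel-layers k (peel-layer k D)

    Minus-dicolourable : Connected G (InSub X) → x ∈ X → Dicolourable G L (OutSub X)
                       → Dicolourable G L (Minus x)
    Minus-dicolourable connected x∈X D with X⊆Within connected x∈X
    ... | M , X⊆WM = peel-layers M (Dicolourable-⊆ G D λ w∉WM w∈X → w∉WM (X⊆WM w∈X))

proposition7p4 : ∀ {n} (G : Digraph n) (X : Subset n) (L : Fin n → List ℕ)
    → Connected G AllV
    → Connected G (InSub X)
    → Dicolourable G L (OutSub X)
    → ¬ Dicolourable G L AllV
    → (∀ x → x ∈ X → card (L x) ≥ outdeg G x ⊔ indeg G x)
    → ∀ x → x ∈ X
    → ((card (L x) ≡ outdeg G x) × (outdeg G x ≡ indeg G x))
      × Dicolourable G L (Minus x)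
      × (∀ φ → IsDicolouring G L (Minus x) φ → ∀ c → c ∈ˡ L x
          → (∃ λ y → Arc G x y × φ y ≡ c) × (∃ λ y → Arc G y x × φ y ≡ c))
      × (∀ φ → IsDicolouring G L (Minus x) φ → ∀ y → y ∈ X → (Arc G x y ⊎ Arc G y x)
          → IsDicolouring G L (Minus y) (recolour φ x y))
proposition7p4 G X L _ connectedX colourable-G−X ¬col dmax x x∈X =
    (card≡outdeg , trans (sym card≡outdeg) card≡indeg)
  , G−x-colourable
  , (λ φ D c c∈Lx → colour-appears G ¬col D c∈Lx outward , colour-appears G ¬col D c∈Lx inward)
  , λ φ D y _ xy → recolour-dicolouring G ¬col D deg≤ xy
  where
  G−x-colourable : Dicolourable G L (Minus x)
  G−x-colourable = Layers.Minus-dicolourable G X x dmax connectedX x∈X colourable-G−X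
  deg≤ : ∀ d → degree G d x ≤ card (L x)
  deg≤ d = ≤-trans (degree≤dmax G d x) (dmax x x∈X)
  card≡outdeg : card (L x) ≡ outdeg G x
  card≡outdeg = card≡degree G ¬col (proj₂ G−x-colourable) outward (deg≤ outward)
  card≡indeg : card (L x) ≡ indeg G x
  card≡indeg = card≡degree G ¬col (proj₂ G−x-colourable) inward (deg≤ inward)
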